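{- Let $(G,H_i)_{i=1}^{q+2}$ be a group packet in $(q+2)\text{ -GP}(n)$ with common pairwise intersection $K$. Then for any $i\neq j$ and any $x,y\in G$ there is $g\in G$ such that $xH_ix^{ -1}\cap yH_jy^{ -1}=gKg^{ -1}$.
   Context: A group packet in $(q+2)\text{ -GP}(n)$ is the data $(G,H_i)_{i=1}^{q+2}$ of a group $G$ and subgroups $H_i\le G$ such that there is a subgroup $K$ with $H_i\cap H_j=K$ for all $i\neq j$ and $[G:H_i]=[H_i:K]=n$ for all $i$. -}

module Defs where

open import Level using (Level; _⊔_; suc)
open import Algebra.Bundles using (Group)
open import Data.Nat using (ℕ; _+_)
open import Data.Fin using (Fin)
open import Data.Product using (_×_; Σ; ∃)
open import Relation.Binary.PropositionalEquality using (_≡_)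
open import Relation.Nullary using (¬_)
open import Relation.Unary using (Pred; U)

module _ {c ℓ : Level} (G : Group c ℓ) where
  open Group G

  record IsSubgroup {p : Level} (H : Pred Carrier p) : Set (c ⊔ ℓ ⊔ p) where
    field
      resp  : ∀ {x y} → x ≈ y → H x → H y
      ε∈    : H ε
      ∙∈    : ∀ {x y} → H x → H y → H (x ∙ y)
      ⁻¹∈   : ∀ {x} → H x → H (x ⁻¹)

  _≐_ : ∀ {p q} → Pred Carrier p → Pred Carrier q → Set (c ⊔ p ⊔ q)
  A ≐ B = ∀ z → (A z → B z) × (B z → A z)

  _∩_ : ∀ {p q} → Pred Carrier p → Pred Carrier q → Pred Carrier (p ⊔ q)
  (A ∩ B) z = A z × B z

  -- Conjugate subset  x A x⁻¹ = { z | x⁻¹ z x ∈ A }.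
  conj : ∀ {p} → Carrier → Pred Carrier p → Pred Carrier p
  conj x A z = A ((x ⁻¹ ∙ z) ∙ x)

  -- [A : B] = n  for subgroups B ≤ A: there are exactly n left cosets of B
  -- in A, witnessed by a left transversal t : Fin n → A.
  Index : ∀ {p q} → Pred Carrier p → Pred Carrier q → ℕ → Set (c ⊔ p ⊔ q)
  Index A B n = Σ (Fin n → Carrier) λ t →
      (∀ k → A (t k))
    × (∀ g → A g → ∃ λ k → B (t k ⁻¹ ∙ g))
    × (∀ k l → B (t k ⁻¹ ∙ t l) → k ≡ l)


  record IsGroupPacket {p} (q n : ℕ) (H : Fin (q + 2) → Pred Carrier p)
                       (K : Pred Carrier p) : Set (c ⊔ ℓ ⊔ p) where
    field
      Hsub   : ∀ i → IsSubgroup (H i)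
      Ksub   : IsSubgroup K
      inter  : ∀ i j → ¬ i ≡ j → (H i ∩ H j) ≐ K
      idxG   : ∀ i → Index U (H i) n
      idxH   : ∀ i → Index (H i) K n

{-# OPTIONS --safe #-}
-- The n cosets sK of K in Hᵢ lie in distinct left cosets of Hⱼ, because
-- s⁻¹s' ∈ Hᵢ ∩ Hⱼ = K forces sK = s'K.  As Hⱼ also has exactly n cosets, all
-- of them are met, so G = HᵢHⱼ.  Writing x⁻¹y = ab with a ∈ Hᵢ, b ∈ Hⱼ and
-- putting g = xa gives xHᵢx⁻¹ = gHᵢg⁻¹ and yHⱼy⁻¹ = gHⱼg⁻¹, hence
-- xHᵢx⁻¹ ∩ yHⱼy⁻¹ = g(Hᵢ ∩ Hⱼ)g⁻¹ = gKg⁻¹.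
module Submission where

open import Defs
open import Level using (Level)
open import Algebra.Bundles using (Group)
open import Data.Nat using (ℕ; zero; suc; _+_)
import Data.Nat.Properties as ℕ
open import Data.Fin using (Fin; punchOut)
open import Data.Fin.Properties using (any?; _≟_; punchOut-injective; injective⇒≤)
open import Data.Product using (∃; ∃₂; _×_; _,_; proj₁; proj₂)
open import Function.Definitions using (Injective)
open import Relation.Binary.Definitions using (_Respects_)
open import Relation.Binary.PropositionalEquality using (_≡_; _≢_; subst)
  renaming (sym to ≡-sym)
open import Relation.Nullary using (¬_; yes; no; contradiction)
open import Relation.Unary using (Pred; U; _⊆_)
import Algebra.Properties.Group as GroupProperties
import Algebra.Solver.Monoid as MonoidSolver

injective⇒surjective : ∀ {n} {f : Fin n → Fin n} → Injective _≡_ _≡_ f →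
                       ∀ k → ∃ λ l → f l ≡ k
injective⇒surjective {zero} _ ()
injective⇒surjective {suc m} {f} f-injective k with any? (λ l → f l ≟ k)
... | yes hit  = hit
... | no  miss = contradiction (injective⇒≤ punchOut-k∘f-injective) ℕ.1+n≰n
  where
  k≢f : ∀ l → k ≢ f l
  k≢f l k≡fl = miss (l , ≡-sym k≡fl)

  -- if k were missed, f followed by deleting k would inject Fin (suc m) into Fin m
  punchOut-k∘f-injective : Injective _≡_ _≡_ (λ l → punchOut (k≢f l))
  punchOut-k∘f-injective eq = f-injective (punchOut-injective (k≢f _) (k≢f _) eq)

module _ {c ℓ : Level} (G : Group c ℓ) where
  open Group G
  open GroupProperties G using (ε⁻¹≈ε; ⁻¹-anti-homo-∙; ⁻¹-involutive; \\-leftDividesˡ)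
  open MonoidSolver monoid using (solve; _⊜_; _⊕_)
  open import Relation.Binary.Reasoning.Setoid setoid

  private
    variable
      ℓ₁ ℓ₂ ℓ₃ : Level
      A A′ B B′ C : Pred Carrier ℓ₁

    infix 4 _≐ᴳ_
    infixr 7 _∩ᴳ_

    _≐ᴳ_ : Pred Carrier ℓ₁ → Pred Carrier ℓ₂ → Set _
    _≐ᴳ_ = _≐_ G

    _∩ᴳ_ : Pred Carrier ℓ₁ → Pred Carrier ℓ₂ → Pred Carrier _
    _∩ᴳ_ = _∩_ G

    conjᴳ : Carrier → Pred Carrier ℓ₁ → Pred Carrier ℓ₁
    conjᴳ = conj G

  ≐-sym : A ≐ᴳ B → B ≐ᴳ A
  ≐-sym A≐B z = proj₂ (A≐B z) , proj₁ (A≐B z)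

  ≐-trans : A ≐ᴳ B → B ≐ᴳ C → A ≐ᴳ C
  ≐-trans A≐B B≐C z =
      (λ Az → proj₁ (B≐C z) (proj₁ (A≐B z) Az))
    , (λ Cz → proj₂ (A≐B z) (proj₂ (B≐C z) Cz))

  ∩-cong : A ≐ᴳ A′ → B ≐ᴳ B′ → A ∩ᴳ B ≐ᴳ A′ ∩ᴳ B′
  ∩-cong A≐A′ B≐B′ z =
      (λ (Az , Bz) → proj₁ (A≐A′ z) Az , proj₁ (B≐B′ z) Bz)
    , (λ (A′z , B′z) → proj₂ (A≐A′ z) A′z , proj₂ (B≐B′ z) B′z)

  infixl 8 _^_

  _^_ : Carrier → Carrier → Carrier
  z ^ x = (x ⁻¹ ∙ z) ∙ x

  conj-cong-≐ : ∀ x → A ≐ᴳ B → conjᴳ x A ≐ᴳ conjᴳ x B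
  conj-cong-≐ x A≐B z = A≐B (z ^ x)

  ^-congˡ : ∀ z {x y} → x ≈ y → z ^ x ≈ z ^ y
  ^-congˡ z x≈y = ∙-cong (∙-congʳ (⁻¹-cong x≈y)) x≈y

  ^-∙ : ∀ z x y → z ^ (x ∙ y) ≈ z ^ x ^ y
  ^-∙ z x y = begin
    (x ∙ y) ⁻¹ ∙ z ∙ (x ∙ y)         ≈⟨ ∙-congʳ (∙-congʳ (⁻¹-anti-homo-∙ x y)) ⟩
    y ⁻¹ ∙ x ⁻¹ ∙ z ∙ (x ∙ y)        ≈⟨ solve 5 (λ y′ x′ z x y →
                                             ((y′ ⊕ x′) ⊕ z) ⊕ (x ⊕ y) ⊜ (y′ ⊕ ((x′ ⊕ z) ⊕ x)) ⊕ y)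
                                           refl (y ⁻¹) (x ⁻¹) z x y ⟩
    y ⁻¹ ∙ (x ⁻¹ ∙ z ∙ x) ∙ y        ∎

  ^-ε : ∀ z → z ^ ε ≈ z
  ^-ε z = begin
    ε ⁻¹ ∙ z ∙ ε  ≈⟨ identityʳ _ ⟩
    ε ⁻¹ ∙ z      ≈⟨ ∙-congʳ ε⁻¹≈ε ⟩
    ε ∙ z         ≈⟨ identityˡ z ⟩
    z             ∎

  ^-inverse : ∀ z x → z ^ x ^ (x ⁻¹) ≈ z
  ^-inverse z x = begin
    z ^ x ^ (x ⁻¹)   ≈⟨ ^-∙ z x (x ⁻¹) ⟨
    z ^ (x ∙ x ⁻¹)   ≈⟨ ^-congˡ z (inverseʳ x) ⟩
    z ^ ε            ≈⟨ ^-ε z ⟩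
    z                ∎

  conj-cong : A Respects _≈_ → ∀ {x y} → x ≈ y → conjᴳ x A ≐ᴳ conjᴳ y A
  conj-cong A-resp x≈y z =
    A-resp (^-congˡ z x≈y) , A-resp (^-congˡ z (sym x≈y))

  conj-∙ : A Respects _≈_ → ∀ x y → conjᴳ (x ∙ y) A ≐ᴳ conjᴳ x (conjᴳ y A)
  conj-∙ A-resp x y z = A-resp (^-∙ z x y) , A-resp (sym (^-∙ z x y))

  module _ {H : Pred Carrier ℓ₁} (H-sub : IsSubgroup G H) where
    open IsSubgroup H-sub

    ^-∈ : ∀ {z h} → H h → H z → H (z ^ h)
    ^-∈ h∈H z∈H = ∙∈ (∙∈ (⁻¹∈ h∈H) z∈H) h∈H

    conj-∈ : ∀ {h} → H h → conjᴳ h H ≐ᴳ H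
    conj-∈ {h} h∈H z =
      (λ zʰ∈H → resp (^-inverse z h) (^-∈ (⁻¹∈ h∈H) zʰ∈H)) , ^-∈ h∈H

    conj-∙-∈ : ∀ x {h} → H h → conjᴳ (x ∙ h) H ≐ᴳ conjᴳ x H
    conj-∙-∈ x h∈H = ≐-trans (conj-∙ resp x _) (conj-cong-≐ x (conj-∈ h∈H))

    sameCoset-sym : ∀ {u v} → H (u ⁻¹ ∙ v) → H (v ⁻¹ ∙ u)
    sameCoset-sym {u} {v} u∼v = resp inverse≈ (⁻¹∈ u∼v)
      where
      inverse≈ : (u ⁻¹ ∙ v) ⁻¹ ≈ v ⁻¹ ∙ u
      inverse≈ = trans (⁻¹-anti-homo-∙ (u ⁻¹) v) (∙-congˡ (⁻¹-involutive u))

    sameCoset-trans : ∀ {u v w} → H (u ⁻¹ ∙ v) → H (v ⁻¹ ∙ w) → H (u ⁻¹ ∙ w)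
    sameCoset-trans {u} {v} {w} u∼v v∼w = resp product≈ (∙∈ u∼v v∼w)
      where
      product≈ : (u ⁻¹ ∙ v) ∙ (v ⁻¹ ∙ w) ≈ u ⁻¹ ∙ w
      product≈ = trans (assoc _ _ _) (∙-congˡ (\\-leftDividesˡ v w))

  Factorises : Pred Carrier ℓ₁ → Pred Carrier ℓ₂ → Set _
  Factorises A B = ∀ g → ∃₂ λ x y → A x × B y × g ≈ x ∙ y

  index⇒factorises : ∀ {n} {A : Pred Carrier ℓ₁} {B : Pred Carrier ℓ₂}
                       {K : Pred Carrier ℓ₃} →
                     IsSubgroup G A → IsSubgroup G B → A ∩ᴳ B ⊆ K →
                     Index G A K n → Index G U B n → Factorises A B
  index⇒factorises {n = n} {A = A} {B = B} A-sub B-sub A∩B⊆K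
                   (s , s∈A , _ , s-distinct) (t , _ , t-covers , _) g =
    s l , s l ⁻¹ ∙ g , s∈A l , sl∼g , sym (\\-leftDividesˡ (s l) g)
    where
    cosetOf : Carrier → Fin n
    cosetOf z = proj₁ (t-covers z _)

    t∼ : ∀ z → B (t (cosetOf z) ⁻¹ ∙ z)
    t∼ z = proj₂ (t-covers z _)

    cosetOf∘s-injective : Injective _≡_ _≡_ (λ k → cosetOf (s k))
    cosetOf∘s-injective {k} {k′} same =
      s-distinct k k′ (A∩B⊆K (sk∼sk′-in-A , sk∼sk′-in-B))
      where
      sk∼sk′-in-A : A (s k ⁻¹ ∙ s k′)
      sk∼sk′-in-A = IsSubgroup.∙∈ A-sub (IsSubgroup.⁻¹∈ A-sub (s∈A k)) (s∈A k′)

      sk∼sk′-in-B : B (s k ⁻¹ ∙ s k′)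
      sk∼sk′-in-B = sameCoset-trans B-sub (sameCoset-sym B-sub (t∼ (s k)))
        (subst (λ m → B (t m ⁻¹ ∙ s k′)) (≡-sym same) (t∼ (s k′)))

    hit : ∃ λ l → cosetOf (s l) ≡ cosetOf g
    hit = injective⇒surjective cosetOf∘s-injective (cosetOf g)

    l : Fin n
    l = proj₁ hit

    sl∼g : B (s l ⁻¹ ∙ g)
    sl∼g = sameCoset-trans B-sub
      (sameCoset-sym B-sub (subst (λ m → B (t m ⁻¹ ∙ s l)) (proj₂ hit) (t∼ (s l))))
      (t∼ g)

  factorises⇒conj-∩-conj : {A : Pred Carrier ℓ₁} {B : Pred Carrier ℓ₂} →
                           IsSubgroup G A → IsSubgroup G B → Factorises A B →
                           ∀ x y → ∃ λ g → conjᴳ x A ∩ᴳ conjᴳ y B ≐ᴳ conjᴳ g (A ∩ᴳ B)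
  factorises⇒conj-∩-conj {B = B} A-sub B-sub factorises x y with factorises (x ⁻¹ ∙ y)
  ... | a , b , a∈A , b∈B , x⁻¹y≈ab =
    x ∙ a , ∩-cong (≐-sym (conj-∙-∈ A-sub x a∈A)) conj-y≐conj-xa
    where
    y≈xab : y ≈ x ∙ a ∙ b
    y≈xab = begin
      y                ≈⟨ \\-leftDividesˡ x y ⟨
      x ∙ (x ⁻¹ ∙ y)   ≈⟨ ∙-congˡ x⁻¹y≈ab ⟩
      x ∙ (a ∙ b)      ≈⟨ assoc x a b ⟨
      x ∙ a ∙ b        ∎

    conj-y≐conj-xa : conjᴳ y B ≐ᴳ conjᴳ (x ∙ a) B
    conj-y≐conj-xa =
      ≐-trans (conj-cong (IsSubgroup.resp B-sub) y≈xab) (conj-∙-∈ B-sub (x ∙ a) b∈B)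

lemma4p3 : ∀ {c ℓ p : Level} (G : Group c ℓ) (q n : ℕ)
    (H : Fin (q + 2) → Pred (Group.Carrier G) p) (K : Pred (Group.Carrier G) p) →
    IsGroupPacket G q n H K →
    ∀ (i j : Fin (q + 2)) → ¬ i ≡ j → ∀ (x y : Group.Carrier G) →
    ∃ λ (g : Group.Carrier G) →
      _≐_ G (_∩_ G (conj G x (H i)) (conj G y (H j))) (conj G g K)
lemma4p3 G q n H K packet i j i≢j x y =
  let g , conj-∩-conj≐ = factorises⇒conj-∩-conj G (Hsub i) (Hsub j) G≐HᵢHⱼ x y
  in  g , ≐-trans G conj-∩-conj≐ (conj-cong-≐ G g (inter i j i≢j))
  where
  open IsGroupPacket packet

  Hᵢ∩Hⱼ⊆K : _∩_ G (H i) (H j) ⊆ K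
  Hᵢ∩Hⱼ⊆K {z} = proj₁ (inter i j i≢j z)

  G≐HᵢHⱼ : Factorises G (H i) (H j)
  G≐HᵢHⱼ = index⇒factorises G (Hsub i) (Hsub j) Hᵢ∩Hⱼ⊆K (idxH i) (idxG j)
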